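{- Let $n,t\ge 2$ and $2\le p<n$ be integers. Let $U_1,\dots,U_t\in\mathbb{Q}^{n\times n}$ be diagonal matrices, let $P\in\mathbb{Q}^{p\times n}$ have rank $p$ and let $Q\in\mathbb{Q}^{n\times n}$ be invertible. Put $W_0=PQ$ (a $p\times n$ matrix of full rank $p$) and $W_a=PU_aQ$ for $a\in[t]$. Let $E\in\mathbb{Q}^{n\times(n-p)}$ be a matrix whose columns form a basis of $\ker(W_0)=\{x\in\mathbb{Q}^n: W_0x=0\}$, let $W_0^+\in\mathbb{Q}^{n\times p}$ be a right inverse of $W_0$ (i.e. $W_0W_0^+=1_p$), and set $V=W_0$ and $Y_a=W_0^+W_a$ for $a\in[t]$. Assume that Problem $\mathbb{C}'$ is uniquely solvable for the input $V,E,\{Y_a\}_{a\in[t]}$, i.e. there is exactly one tuple $(X_1,\dots,X_t)$ of matrices $X_a\in\mathbb{Q}^{(n-p)\times n}$ such that the matrices $Y_a+EX_a$, $a\in[t]$, pairwise commute. Then Problem $\mathbb{C}$ is uniquely solvable for the input $\{W_a:0\le a\le t\}$, i.e. the set $\{(u_{1,i},\dots,u_{t,i}):1\le i\le n\}$ is the same for every choice of $P'\in\mathbb{Q}^{p\times n}$ of rank $p$, invertible $Q'\in\mathbb{Q}^{n\times n}$ and diagonal $U'_1,\dots,U'_t\in\mathbb{Q}^{n\times n}$ with $W_0=P'Q'$ and $W_a=P'U'_aQ'$ for all $a\in[t]$ (where $u_{a,1},\dots,u_{a,n}$ denote the diagonal entries of the respective $a$-th diagonal matrix). Moreover, if at least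 one of the matrices $U_1,\dots,U_t$ has pairwise distinct diagonal entries, then the matrix $Q$ is unique up to multiplication by a permutation matrix and an invertible diagonal matrix: for any such $P',Q',\{U'_a\}$ there exist a permutation matrix $A$ and an invertible diagonal matrix $D$ with $Q=DAQ'$.
   Context: Notation: $[t]=\{1,\dots,t\}$, $1_p$ is the $p\times p$ identity matrix. Problem $\mathbb{C}$ (instance of the matrix problem with $p<n$, $q=n$): given $W_0=PQ$ and $W_a=PU_aQ$ ($a\in[t]$) with $P\in\mathbb{Q}^{p\times n}$ of rank $p$, $Q\in\mathbb{Q}^{n\times n}$ of rank $n$, $U_a$ diagonal, recover the set of tuples $\{(u_{1,i},\dots,u_{t,i}):1\le i\le n\}$ of diagonal entries of the $U_a$. Problem $\mathbb{C}'$: given $V\in\mathbb{Q}^{p\times n}$ of rank $p$, a basis matrix $E\in\mathbb{Q}^{n\times(n-p)}$ of $\ker(V)$ and matrices $Y_1,\dots,Y_t\in\mathbb{Q}^{n\times n}$, compute $X_1,\dots,X_t\in\mathbb{Q}^{(n-p)\times n}$ such that the matrices $Y_a+EX_a$ pairwise commute. -}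

module Defs where

open import Data.Nat using (ℕ; zero; suc; _∸_)
open import Data.Fin using (Fin; zero; suc; _≟_)
open import Data.Rational using (ℚ; 0ℚ; 1ℚ; _+_; _*_)
open import Data.Product using (Σ; ∃; _×_; _,_)
open import Data.Bool using (if_then_else_)
open import Relation.Nullary using (¬_)
open import Relation.Nullary.Decidable using (⌊_⌋)
open import Relation.Binary.PropositionalEquality using (_≡_)
open import Data.Fin.Permutation using (Permutation′; _⟨$⟩ʳ_)

Mat : ℕ → ℕ → Set
Mat m n = Fin m → Fin n → ℚ

Vect : ℕ → Set
Vect n = Fin n → ℚ

∑ : ∀ {n} → (Fin n → ℚ) → ℚ
∑ {zero}  f = 0ℚ
∑ {suc n} f = f zero + ∑ (λ i → f (suc i))

infixl 7 _⊗_
_⊗_ : ∀ {m k n} → Mat m k → Mat k n → Mat m n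
(A ⊗ B) i j = ∑ (λ l → A i l * B l j)

_·_ : ∀ {m n} → Mat m n → Vect n → Vect m
(A · x) i = ∑ (λ l → A i l * x l)

infixl 6 _⊕_
infixl 7 _·_
_⊕_ : ∀ {m n} → Mat m n → Mat m n → Mat m n
(A ⊕ B) i j = A i j + B i j

infix 4 _≐_ _≐ᵥ_
_≐_ : ∀ {m n} → Mat m n → Mat m n → Set
A ≐ B = ∀ i j → A i j ≡ B i j

_≐ᵥ_ : ∀ {n} → Vect n → Vect n → Set
x ≐ᵥ y = ∀ i → x i ≡ y i

0ᵥ : ∀ {n} → Vect n
0ᵥ _ = 0ℚ

0ₘ : ∀ {m n} → Mat m n
0ₘ _ _ = 0ℚ

δ : ∀ {n} → Fin n → Fin n → ℚ
δ i j = if ⌊ i ≟ j ⌋ then 1ℚ else 0ℚ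

1ₘ : ∀ {n} → Mat n n
1ₘ = δ

diag : ∀ {n} → Vect n → Mat n n
diag d i j = if ⌊ i ≟ j ⌋ then d i else 0ℚ

rowComb : ∀ {m n} → Vect m → Mat m n → Vect n
rowComb c A j = ∑ (λ i → c i * A i j)

HasFullRowRank : ∀ {p n} → Mat p n → Set
HasFullRowRank {p} A = ∀ (c : Vect p) → rowComb c A ≐ᵥ 0ᵥ → c ≐ᵥ 0ᵥ

Invertible : ∀ {n} → Mat n n → Set
Invertible {n} A = Σ (Mat n n) λ B → (A ⊗ B ≐ 1ₘ) × (B ⊗ A ≐ 1ₘ)

ColumnsBasisOfKer : ∀ {p n k} → Mat n k → Mat p n → Set
ColumnsBasisOfKer {p} {n} {k} E W =
    (∀ (c : Vect k) → (W · (E · c)) ≐ᵥ 0ᵥ)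
  × (∀ (c : Vect k) → (E · c) ≐ᵥ 0ᵥ → c ≐ᵥ 0ᵥ)
  × (∀ (x : Vect n) → (W · x) ≐ᵥ 0ᵥ → ∃ λ (c : Vect k) → (E · c) ≐ᵥ x)

SolvesC′ : ∀ {n k t} → Mat n k → (Fin t → Mat n n) → (Fin t → Mat k n) → Set
SolvesC′ E Y X =
  ∀ a b → ((Y a ⊕ (E ⊗ X a)) ⊗ (Y b ⊕ (E ⊗ X b)))
        ≐ ((Y b ⊕ (E ⊗ X b)) ⊗ (Y a ⊕ (E ⊗ X a)))

UniquelySolvableC′ : ∀ {n k t} → Mat n k → (Fin t → Mat n n) → Set
UniquelySolvableC′ {n} {k} {t} E Y =
    (∃ λ (X : Fin t → Mat k n) → SolvesC′ E Y X)
  × (∀ (X X′ : Fin t → Mat k n) → SolvesC′ E Y X → SolvesC′ E Y X′ → ∀ a → X a ≐ X′ a)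

IsDecomposition : ∀ {p n t} → Mat p n → (Fin t → Mat p n)
                → Mat p n → Mat n n → (Fin t → Vect n) → Set
IsDecomposition W₀ W P′ Q′ u′ =
    HasFullRowRank P′ × Invertible Q′
  × (W₀ ≐ (P′ ⊗ Q′))
  × (∀ a → W a ≐ (P′ ⊗ diag (u′ a) ⊗ Q′))

SameTupleSet : ∀ {n t} → (Fin t → Vect n) → (Fin t → Vect n) → Set
SameTupleSet {n} u u′ =
    (∀ i → ∃ λ (j : Fin n) → ∀ a → u a i ≡ u′ a j)
  × (∀ j → ∃ λ (i : Fin n) → ∀ a → u a i ≡ u′ a j)

PairwiseDistinct : ∀ {n} → Vect n → Set
PairwiseDistinct d = ∀ i j → d i ≡ d j → i ≡ j

permMat : ∀ {n} → Permutation′ n → Mat n n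
permMat σ i j = if ⌊ (σ ⟨$⟩ʳ i) ≟ j ⌋ then 1ℚ else 0ℚ

{-# OPTIONS --safe #-}
module Submission where

open import Defs
open import Data.Nat using (ℕ; _≤_; _<_; _∸_)
open import Data.Fin using (Fin)
open import Data.Rational using (ℚ; 0ℚ)
open import Data.Product using (Σ; ∃; _×_)
open import Relation.Nullary using (¬_)
open import Relation.Binary.PropositionalEquality using (_≡_)
open import Data.Fin.Permutation using (Permutation′)

open import Algebra.Bundles using (CommutativeRing)
open import Data.Nat using (zero; suc)
open import Data.Fin using (zero; suc; _≟_)
open import Data.Fin.Permutation using (permutation)
open import Data.Fin.Properties using (¬∀⟶∃¬; punchInᵢ≢i)
open import Data.Product using (_,_; proj₁; proj₂)
open import Data.Rational using (1ℚ; _+_; _*_; _-_; 1/_; NonZero; ≢-nonZero)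
open import Data.Rational.Solver using (module +-*-Solver)
open import Data.Vec.Functional using (removeAt)
open import Function using (_∘_)
open import Level using (0ℓ)
open import Relation.Binary.Bundles using (Setoid)
open import Relation.Binary.PropositionalEquality
  using (_≢_; refl; sym; trans; cong; cong₂; module ≡-Reasoning)
open import Relation.Nullary using (yes; no; contradiction)
open import Relation.Nullary.Decidable using (decidable-stable)
import Algebra.Properties.Group
import Algebra.Properties.Semiring.Sum
import Data.Rational.Properties as ℚ
import Relation.Binary.Reasoning.Setoid

-- Any decomposition W₀ = P′Q′, W_a = P′U′_aQ′ gives pairwise commuting matrices
-- Z′_a = Q′⁻¹U′_aQ′ with W₀Z′_a = W_a, and each of them has the form Y_a + E X_a
-- because its columns differ from those of Y_a by vectors of ker W₀.  Uniqueness
-- for Problem C′ thus forces Q⁻¹U_aQ = Q′⁻¹U′_aQ′, i.e. the invertible matrix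
-- M = QQ′⁻¹ satisfies U_a M = M U′_a.  Read entrywise, M_ij ≠ 0 forces
-- u_{a,i} = u′_{a,j} for every a, and every row and every column of M has a
-- nonzero entry, so the tuple sets agree.  If some u_a has distinct entries, each
-- column of M has a single nonzero entry, so M is a scaled permutation matrix and
-- Q = MQ′.

module Sum = Algebra.Properties.Semiring.Sum (CommutativeRing.semiring ℚ.+-*-commutativeRing)
module +-Group = Algebra.Properties.Group ℚ.+-0-group

∑≡sum : ∀ {n} (f : Fin n → ℚ) → ∑ f ≡ Sum.sum f
∑≡sum {zero}  f = refl
∑≡sum {suc n} f = cong (f zero +_) (∑≡sum (f ∘ suc))

∑-cong : ∀ {n} {f g : Fin n → ℚ} → (∀ i → f i ≡ g i) → ∑ f ≡ ∑ g
∑-cong {f = f} {g} f≗g = trans (∑≡sum f) (trans (Sum.sum-cong-≗ f≗g) (sym (∑≡sum g)))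

∑-zero : ∀ n → ∑ {n} (λ _ → 0ℚ) ≡ 0ℚ
∑-zero n = trans (∑≡sum {n} (λ _ → 0ℚ)) (Sum.sum-replicate-zero n)

∑-distrib-+ : ∀ {n} (f g : Fin n → ℚ) → ∑ (λ i → f i + g i) ≡ ∑ f + ∑ g
∑-distrib-+ f g = trans (∑≡sum (λ i → f i + g i))
  (trans (Sum.∑-distrib-+ f g) (sym (cong₂ _+_ (∑≡sum f) (∑≡sum g))))

*-distribˡ-∑ : ∀ {n} x (f : Fin n → ℚ) → x * ∑ f ≡ ∑ (λ i → x * f i)
*-distribˡ-∑ x f = trans (cong (x *_) (∑≡sum f))
  (trans (Sum.*-distribˡ-sum x f) (sym (∑≡sum (λ i → x * f i))))

*-distribʳ-∑ : ∀ {n} x (f : Fin n → ℚ) → ∑ f * x ≡ ∑ (λ i → f i * x)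
*-distribʳ-∑ x f = trans (cong (_* x) (∑≡sum f))
  (trans (Sum.*-distribʳ-sum x f) (sym (∑≡sum (λ i → f i * x))))

∑-comm : ∀ {m n} (f : Fin m → Fin n → ℚ) → ∑ (λ i → ∑ (f i)) ≡ ∑ (λ j → ∑ (λ i → f i j))
∑-comm f = trans (∑∑≡sumsum f) (trans (Sum.∑-comm f) (sym (∑∑≡sumsum (λ j i → f i j))))
  where
  ∑∑≡sumsum : ∀ {m n} (g : Fin m → Fin n → ℚ) →
              ∑ (λ i → ∑ (g i)) ≡ Sum.sum (λ i → Sum.sum (g i))
  ∑∑≡sumsum g = trans (∑≡sum (λ i → ∑ (g i))) (Sum.sum-cong-≗ (λ i → ∑≡sum (g i)))

∑-single : ∀ {n} (i : Fin n) (f : Fin n → ℚ) → (∀ j → j ≢ i → f j ≡ 0ℚ) → ∑ f ≡ f i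
∑-single {suc n} i f f≡0 = begin
  ∑ f                           ≡⟨ ∑≡sum f ⟩
  Sum.sum f                     ≡⟨ Sum.sum-remove f ⟩
  f i + Sum.sum (removeAt f i)  ≡⟨ cong (f i +_) rest≡0 ⟩
  f i + 0ℚ                      ≡⟨ ℚ.+-identityʳ (f i) ⟩
  f i                           ∎
  where
  open ≡-Reasoning
  rest≡0 : Sum.sum (removeAt f i) ≡ 0ℚ
  rest≡0 = trans (Sum.sum-cong-≗ (λ k → f≡0 _ (punchInᵢ≢i i k)))
                 (Sum.sum-replicate-zero n)

*-cancelʳ-≡ : ∀ x y z → z ≢ 0ℚ → x * z ≡ y * z → x ≡ y
*-cancelʳ-≡ x y z z≢0 xz≡yz = begin
  x               ≡⟨ sym (ℚ.*-identityʳ x) ⟩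
  x * 1ℚ          ≡⟨ cong (x *_) (sym (ℚ.*-inverseʳ z)) ⟩
  x * (z * 1/ z)  ≡⟨ sym (ℚ.*-assoc x z (1/ z)) ⟩
  x * z * 1/ z    ≡⟨ cong (_* 1/ z) xz≡yz ⟩
  y * z * 1/ z    ≡⟨ ℚ.*-assoc y z (1/ z) ⟩
  y * (z * 1/ z)  ≡⟨ cong (y *_) (ℚ.*-inverseʳ z) ⟩
  y * 1ℚ          ≡⟨ ℚ.*-identityʳ y ⟩
  y               ∎
  where
  open ≡-Reasoning
  instance
    z-nonZero : NonZero z
    z-nonZero = ≢-nonZero z≢0

≐-refl : ∀ {m n} {A : Mat m n} → A ≐ A
≐-refl i j = refl

≐-sym : ∀ {m n} {A B : Mat m n} → A ≐ B → B ≐ A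
≐-sym A≐B i j = sym (A≐B i j)

≐-trans : ∀ {m n} {A B C : Mat m n} → A ≐ B → B ≐ C → A ≐ C
≐-trans A≐B B≐C i j = trans (A≐B i j) (B≐C i j)

≐-setoid : ℕ → ℕ → Setoid 0ℓ 0ℓ
≐-setoid m n = record
  { Carrier       = Mat m n
  ; _≈_           = _≐_
  ; isEquivalence = record { refl = ≐-refl ; sym = ≐-sym ; trans = ≐-trans }
  }

module ≐-Reasoning {m n : ℕ} = Relation.Binary.Reasoning.Setoid (≐-setoid m n)

⊗-cong : ∀ {m k n} {A A′ : Mat m k} {B B′ : Mat k n} → A ≐ A′ → B ≐ B′ → A ⊗ B ≐ A′ ⊗ B′
⊗-cong A≐A′ B≐B′ i j = ∑-cong (λ l → cong₂ _*_ (A≐A′ i l) (B≐B′ l j))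

⊗-congˡ : ∀ {m k n} (A : Mat m k) {B B′ : Mat k n} → B ≐ B′ → A ⊗ B ≐ A ⊗ B′
⊗-congˡ A = ⊗-cong (≐-refl {A = A})

⊗-congʳ : ∀ {m k n} {A A′ : Mat m k} (B : Mat k n) → A ≐ A′ → A ⊗ B ≐ A′ ⊗ B
⊗-congʳ B A≐A′ = ⊗-cong A≐A′ (≐-refl {A = B})

⊗-assoc : ∀ {m k l n} (A : Mat m k) (B : Mat k l) (C : Mat l n) → A ⊗ B ⊗ C ≐ A ⊗ (B ⊗ C)
⊗-assoc A B C i j = begin
  ∑ (λ l → ∑ (λ m → A i m * B m l) * C l j)
    ≡⟨ ∑-cong (λ l → *-distribʳ-∑ (C l j) (λ m → A i m * B m l)) ⟩
  ∑ (λ l → ∑ (λ m → A i m * B m l * C l j))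
    ≡⟨ ∑-comm (λ l m → A i m * B m l * C l j) ⟩
  ∑ (λ m → ∑ (λ l → A i m * B m l * C l j))
    ≡⟨ ∑-cong (λ m → ∑-cong (λ l → ℚ.*-assoc (A i m) (B m l) (C l j))) ⟩
  ∑ (λ m → ∑ (λ l → A i m * (B m l * C l j)))
    ≡⟨ ∑-cong (λ m → sym (*-distribˡ-∑ (A i m) (λ l → B m l * C l j))) ⟩
  ∑ (λ m → A i m * ∑ (λ l → B m l * C l j))
    ∎
  where open ≡-Reasoning

⊗-distribˡ-⊕ : ∀ {m k n} (A : Mat m k) (B C : Mat k n) → A ⊗ (B ⊕ C) ≐ A ⊗ B ⊕ A ⊗ C
⊗-distribˡ-⊕ A B C i j = trans (∑-cong (λ l → ℚ.*-distribˡ-+ (A i l) (B l j) (C l j)))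
                                (∑-distrib-+ (λ l → A i l * B l j) (λ l → A i l * C l j))

diag-on : ∀ {n} (d : Vect n) i → diag d i i ≡ d i
diag-on d i with i ≟ i
... | yes _  = refl
... | no i≢i = contradiction refl i≢i

diag-off : ∀ {n} (d : Vect n) {i j} → i ≢ j → diag d i j ≡ 0ℚ
diag-off d {i} {j} i≢j with i ≟ j
... | yes i≡j = contradiction i≡j i≢j
... | no _    = refl

diag-⊗ : ∀ {m n} (d : Vect m) (A : Mat m n) i j → (diag d ⊗ A) i j ≡ d i * A i j
diag-⊗ d A i j = trans
  (∑-single i _ (λ l l≢i → trans (cong (_* A l j) (diag-off d (l≢i ∘ sym))) (ℚ.*-zeroˡ (A l j))))
  (cong (_* A i j) (diag-on d i))

⊗-diag : ∀ {m n} (d : Vect n) (A : Mat m n) i j → (A ⊗ diag d) i j ≡ A i j * d j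
⊗-diag d A i j = trans
  (∑-single j _ (λ l l≢j → trans (cong (A i l *_) (diag-off d l≢j)) (ℚ.*-zeroʳ (A i l))))
  (cong (A i j *_) (diag-on d j))

-- 1ₘ is definitionally diag (λ _ → 1ℚ).
⊗-identityˡ : ∀ {m n} (A : Mat m n) → 1ₘ ⊗ A ≐ A
⊗-identityˡ A i j = trans (diag-⊗ (λ _ → 1ℚ) A i j) (ℚ.*-identityˡ (A i j))

⊗-identityʳ : ∀ {m n} (A : Mat m n) → A ⊗ 1ₘ ≐ A
⊗-identityʳ A i j = trans (⊗-diag (λ _ → 1ℚ) A i j) (ℚ.*-identityʳ (A i j))

diag-comm : ∀ {n} (d e : Vect n) → diag d ⊗ diag e ≐ diag e ⊗ diag d
diag-comm d e i j = trans (diag-⊗ d (diag e) i j) (trans entries (sym (diag-⊗ e (diag d) i j)))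
  where
  entries : d i * diag e i j ≡ e i * diag d i j
  entries with i ≟ j
  ... | yes refl = ℚ.*-comm (d i) (e i)
  ... | no _     = trans (ℚ.*-zeroʳ (d i)) (sym (ℚ.*-zeroʳ (e i)))

⊗-cancelˡ : ∀ {m k n} (A : Mat m k) (B : Mat k m) (C : Mat m n) → A ⊗ B ≐ 1ₘ → A ⊗ (B ⊗ C) ≐ C
⊗-cancelˡ A B C AB≐1 = begin
  A ⊗ (B ⊗ C)  ≈⟨ ≐-sym (⊗-assoc A B C) ⟩
  A ⊗ B ⊗ C    ≈⟨ ⊗-congʳ C AB≐1 ⟩
  1ₘ ⊗ C       ≈⟨ ⊗-identityˡ C ⟩
  C            ∎
  where open ≐-Reasoning

⊗-cancelʳ : ∀ {m k n} (A : Mat m k) (B : Mat k m) (C : Mat n m) → A ⊗ B ≐ 1ₘ → C ⊗ A ⊗ B ≐ C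
⊗-cancelʳ A B C AB≐1 = begin
  C ⊗ A ⊗ B    ≈⟨ ⊗-assoc C A B ⟩
  C ⊗ (A ⊗ B)  ≈⟨ ⊗-congˡ C AB≐1 ⟩
  C ⊗ 1ₘ       ≈⟨ ⊗-identityʳ C ⟩
  C            ∎
  where open ≐-Reasoning

⊗-inverse : ∀ {n} (A B C D : Mat n n) → A ⊗ B ≐ 1ₘ → C ⊗ D ≐ 1ₘ → (A ⊗ C) ⊗ (D ⊗ B) ≐ 1ₘ
⊗-inverse A B C D AB≐1 CD≐1 = begin
  (A ⊗ C) ⊗ (D ⊗ B)  ≈⟨ ⊗-assoc A C (D ⊗ B) ⟩
  A ⊗ (C ⊗ (D ⊗ B))  ≈⟨ ⊗-congˡ A (⊗-cancelˡ C D B CD≐1) ⟩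
  A ⊗ B              ≈⟨ AB≐1 ⟩
  1ₘ                 ∎
  where open ≐-Reasoning

⊗-conjugate : ∀ {m n} (X : Mat m n) (Q Qi A : Mat n n) → Q ⊗ Qi ≐ 1ₘ →
              (X ⊗ Q) ⊗ (Qi ⊗ A ⊗ Q) ≐ X ⊗ A ⊗ Q
⊗-conjugate X Q Qi A QQi≐1 = begin
  (X ⊗ Q) ⊗ (Qi ⊗ A ⊗ Q)    ≈⟨ ⊗-assoc X Q (Qi ⊗ A ⊗ Q) ⟩
  X ⊗ (Q ⊗ (Qi ⊗ A ⊗ Q))    ≈⟨ ⊗-congˡ X (⊗-congˡ Q (⊗-assoc Qi A Q)) ⟩
  X ⊗ (Q ⊗ (Qi ⊗ (A ⊗ Q)))  ≈⟨ ⊗-congˡ X (⊗-cancelˡ Q Qi (A ⊗ Q) QQi≐1) ⟩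
  X ⊗ (A ⊗ Q)               ≈⟨ ≐-sym (⊗-assoc X A Q) ⟩
  X ⊗ A ⊗ Q                 ∎
  where open ≐-Reasoning

conjugate-comm : ∀ {n} (Q Qi A B : Mat n n) → Q ⊗ Qi ≐ 1ₘ → A ⊗ B ≐ B ⊗ A →
                 (Qi ⊗ A ⊗ Q) ⊗ (Qi ⊗ B ⊗ Q) ≐ (Qi ⊗ B ⊗ Q) ⊗ (Qi ⊗ A ⊗ Q)
conjugate-comm Q Qi A B QQi≐1 AB≐BA = begin
  (Qi ⊗ A ⊗ Q) ⊗ (Qi ⊗ B ⊗ Q)  ≈⟨ ⊗-conjugate (Qi ⊗ A) Q Qi B QQi≐1 ⟩
  Qi ⊗ A ⊗ B ⊗ Q               ≈⟨ ⊗-congʳ Q (⊗-assoc Qi A B) ⟩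
  Qi ⊗ (A ⊗ B) ⊗ Q             ≈⟨ ⊗-congʳ Q (⊗-congˡ Qi AB≐BA) ⟩
  Qi ⊗ (B ⊗ A) ⊗ Q             ≈⟨ ⊗-congʳ Q (≐-sym (⊗-assoc Qi B A)) ⟩
  Qi ⊗ B ⊗ A ⊗ Q               ≈⟨ ≐-sym (⊗-conjugate (Qi ⊗ B) Q Qi A QQi≐1) ⟩
  (Qi ⊗ B ⊗ Q) ⊗ (Qi ⊗ A ⊗ Q)  ∎
  where open ≐-Reasoning

conjugates-≐⇒intertwine : ∀ {n} (Q Qi Q′ Q′i A B : Mat n n) → Q ⊗ Qi ≐ 1ₘ → Q′ ⊗ Q′i ≐ 1ₘ →
                          Qi ⊗ A ⊗ Q ≐ Q′i ⊗ B ⊗ Q′ → A ⊗ (Q ⊗ Q′i) ≐ (Q ⊗ Q′i) ⊗ B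
conjugates-≐⇒intertwine Q Qi Q′ Q′i A B QQi≐1 Q′Q′i≐1 conj≐ = begin
  A ⊗ (Q ⊗ Q′i)               ≈⟨ ≐-sym (⊗-assoc A Q Q′i) ⟩
  A ⊗ Q ⊗ Q′i                 ≈⟨ ⊗-congʳ Q′i (≐-sym (⊗-cancelˡ Q Qi (A ⊗ Q) QQi≐1)) ⟩
  Q ⊗ (Qi ⊗ (A ⊗ Q)) ⊗ Q′i    ≈⟨ ⊗-congʳ Q′i (⊗-congˡ Q (≐-sym (⊗-assoc Qi A Q))) ⟩
  Q ⊗ (Qi ⊗ A ⊗ Q) ⊗ Q′i      ≈⟨ ⊗-congʳ Q′i (⊗-congˡ Q conj≐) ⟩
  Q ⊗ (Q′i ⊗ B ⊗ Q′) ⊗ Q′i    ≈⟨ ⊗-congʳ Q′i (≐-sym (⊗-assoc Q (Q′i ⊗ B) Q′)) ⟩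
  Q ⊗ (Q′i ⊗ B) ⊗ Q′ ⊗ Q′i    ≈⟨ ⊗-congʳ Q′i (⊗-congʳ Q′ (≐-sym (⊗-assoc Q Q′i B))) ⟩
  Q ⊗ Q′i ⊗ B ⊗ Q′ ⊗ Q′i      ≈⟨ ⊗-cancelʳ Q′ Q′i (Q ⊗ Q′i ⊗ B) Q′Q′i≐1 ⟩
  Q ⊗ Q′i ⊗ B                 ∎
  where open ≐-Reasoning

ColumnsSpanKer : ∀ {p n k} → Mat n k → Mat p n → Set
ColumnsSpanKer {n = n} {k} E W = ∀ (x : Vect n) → (W · x) ≐ᵥ 0ᵥ → ∃ λ (c : Vect k) → (E · c) ≐ᵥ x

PairwiseCommuting : ∀ {n t} → (Fin t → Mat n n) → Set
PairwiseCommuting Z = ∀ a b → Z a ⊗ Z b ≐ Z b ⊗ Z a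

PairwiseCommuting-resp : ∀ {n t} {Z Z′ : Fin t → Mat n n} →
                         (∀ a → Z a ≐ Z′ a) → PairwiseCommuting Z → PairwiseCommuting Z′
PairwiseCommuting-resp {Z = Z} {Z′} Z≐Z′ Z-comm a b = begin
  Z′ a ⊗ Z′ b  ≈⟨ ⊗-cong (≐-sym (Z≐Z′ a)) (≐-sym (Z≐Z′ b)) ⟩
  Z a ⊗ Z b    ≈⟨ Z-comm a b ⟩
  Z b ⊗ Z a    ≈⟨ ⊗-cong (Z≐Z′ b) (Z≐Z′ a) ⟩
  Z′ b ⊗ Z′ a  ∎
  where open ≐-Reasoning

lift-through-kernel : ∀ {p n k} (W₀ : Mat p n) (W₀⁺ : Mat n p) (E : Mat n k) →
                      ColumnsSpanKer E W₀ → W₀ ⊗ W₀⁺ ≐ 1ₘ →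
                      (W : Mat p n) (Z : Mat n n) → W₀ ⊗ Z ≐ W →
                      ∃ λ (X : Mat k n) → W₀⁺ ⊗ W ⊕ E ⊗ X ≐ Z
lift-through-kernel {p} {n} {k} W₀ W₀⁺ E span W₀W₀⁺≐1 W Z W₀Z≐W = X , Y⊕EX≐Z
  where
  open +-*-Solver
  Y D : Mat n n
  Y = W₀⁺ ⊗ W
  D l j = Z l j - Y l j

  Y⊕D≐Z : Y ⊕ D ≐ Z
  Y⊕D≐Z i j = solve 2 (λ y z → y :+ (z :- y) := z) refl (Y i j) (Z i j)

  W₀D≐0 : ∀ j → (W₀ · (λ l → D l j)) ≐ᵥ 0ᵥ
  W₀D≐0 j i = +-Group.identityʳ-unique (W i j) ((W₀ ⊗ D) i j) (begin
    W i j + (W₀ ⊗ D) i j          ≡⟨ cong (_+ (W₀ ⊗ D) i j) (sym (W₀Y≐W i j)) ⟩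
    (W₀ ⊗ Y) i j + (W₀ ⊗ D) i j   ≡⟨ sym (⊗-distribˡ-⊕ W₀ Y D i j) ⟩
    (W₀ ⊗ (Y ⊕ D)) i j            ≡⟨ ⊗-congˡ W₀ Y⊕D≐Z i j ⟩
    (W₀ ⊗ Z) i j                  ≡⟨ W₀Z≐W i j ⟩
    W i j                         ∎)
    where
    open ≡-Reasoning
    W₀Y≐W : W₀ ⊗ Y ≐ W
    W₀Y≐W = ⊗-cancelˡ W₀ W₀⁺ W W₀W₀⁺≐1

  X : Mat k n
  X i j = proj₁ (span (λ l → D l j) (W₀D≐0 j)) i

  Y⊕EX≐Z : Y ⊕ E ⊗ X ≐ Z
  Y⊕EX≐Z i j =
    trans (cong (Y i j +_) (proj₂ (span (λ l → D l j) (W₀D≐0 j)) i)) (Y⊕D≐Z i j)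

commuting-lifts-unique :
  ∀ {p n k t} (W₀ : Mat p n) (W₀⁺ : Mat n p) (E : Mat n k) (W : Fin t → Mat p n) →
  ColumnsSpanKer E W₀ → W₀ ⊗ W₀⁺ ≐ 1ₘ → UniquelySolvableC′ E (λ a → W₀⁺ ⊗ W a) →
  (Z Z′ : Fin t → Mat n n) → (∀ a → W₀ ⊗ Z a ≐ W a) → (∀ a → W₀ ⊗ Z′ a ≐ W a) →
  PairwiseCommuting Z → PairwiseCommuting Z′ → ∀ a → Z a ≐ Z′ a
commuting-lifts-unique {p} {n} {k} {t} W₀ W₀⁺ E W span W₀W₀⁺≐1 (_ , unique)
                       Z Z′ W₀Z≐W W₀Z′≐W Z-comm Z′-comm a = begin
    Z a                   ≈⟨ ≐-sym (Y⊕EX≐Z a) ⟩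
    W₀⁺ ⊗ W a ⊕ E ⊗ X a   ≈⟨ (λ i j → cong ((W₀⁺ ⊗ W a) i j +_) (⊗-congˡ E (X≐X′ a) i j)) ⟩
    W₀⁺ ⊗ W a ⊕ E ⊗ X′ a  ≈⟨ Y⊕EX′≐Z′ a ⟩
    Z′ a                  ∎
  where
  open ≐-Reasoning
  lift : (V : Mat p n) (Y : Mat n n) → W₀ ⊗ Y ≐ V → ∃ λ (X : Mat k n) → W₀⁺ ⊗ V ⊕ E ⊗ X ≐ Y
  lift = lift-through-kernel W₀ W₀⁺ E span W₀W₀⁺≐1
  X X′ : Fin t → Mat k n
  X  a = proj₁ (lift (W a) (Z a) (W₀Z≐W a))
  X′ a = proj₁ (lift (W a) (Z′ a) (W₀Z′≐W a))
  Y⊕EX≐Z : ∀ a → W₀⁺ ⊗ W a ⊕ E ⊗ X a ≐ Z a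
  Y⊕EX≐Z a = proj₂ (lift (W a) (Z a) (W₀Z≐W a))
  Y⊕EX′≐Z′ : ∀ a → W₀⁺ ⊗ W a ⊕ E ⊗ X′ a ≐ Z′ a
  Y⊕EX′≐Z′ a = proj₂ (lift (W a) (Z′ a) (W₀Z′≐W a))
  -- SolvesC′ E Y X unfolds to PairwiseCommuting (λ a → Y a ⊕ E ⊗ X a).
  X≐X′ : ∀ a → X a ≐ X′ a
  X≐X′ = unique X X′ (PairwiseCommuting-resp (≐-sym ∘ Y⊕EX≐Z) Z-comm)
                     (PairwiseCommuting-resp (≐-sym ∘ Y⊕EX′≐Z′) Z′-comm)

Intertwines : ∀ {n t} → Mat n n → (Fin t → Vect n) → (Fin t → Vect n) → Set
Intertwines M u u′ = ∀ a → diag (u a) ⊗ M ≐ M ⊗ diag (u′ a)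

intertwiner-support : ∀ {n} {u u′ : Vect n} (M : Mat n n) → diag u ⊗ M ≐ M ⊗ diag u′ →
                      ∀ {i j} → M i j ≢ 0ℚ → u i ≡ u′ j
intertwiner-support {u = u} {u′} M uM≐Mu′ {i} {j} Mij≢0 =
  *-cancelʳ-≡ (u i) (u′ j) (M i j) Mij≢0 (begin
    u i * M i j        ≡⟨ sym (diag-⊗ u M i j) ⟩
    (diag u ⊗ M) i j   ≡⟨ uM≐Mu′ i j ⟩
    (M ⊗ diag u′) i j  ≡⟨ ⊗-diag u′ M i j ⟩
    M i j * u′ j       ≡⟨ ℚ.*-comm (M i j) (u′ j) ⟩
    u′ j * M i j       ∎)
  where open ≡-Reasoning

row-nonzero : ∀ {n} (M N : Mat n n) → M ⊗ N ≐ 1ₘ → ∀ i → ∃ λ j → M i j ≢ 0ℚ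
row-nonzero {n} M N MN≐1 i = ¬∀⟶∃¬ n _ (λ j → M i j ℚ.≟ 0ℚ) λ row≡0 → ℚ.1≢0 (begin
  1ℚ                       ≡⟨ sym (diag-on (λ _ → 1ℚ) i) ⟩
  1ₘ {n} i i               ≡⟨ sym (MN≐1 i i) ⟩
  ∑ (λ l → M i l * N l i)  ≡⟨ ∑-cong (λ l → cong (_* N l i) (row≡0 l)) ⟩
  ∑ (λ l → 0ℚ * N l i)     ≡⟨ ∑-cong (λ l → ℚ.*-zeroˡ (N l i)) ⟩
  ∑ {n} (λ _ → 0ℚ)         ≡⟨ ∑-zero n ⟩
  0ℚ                       ∎)
  where open ≡-Reasoning

column-nonzero : ∀ {n} (M N : Mat n n) → N ⊗ M ≐ 1ₘ → ∀ j → ∃ λ i → M i j ≢ 0ℚ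
column-nonzero {n} M N NM≐1 j = ¬∀⟶∃¬ n _ (λ i → M i j ℚ.≟ 0ℚ) λ column≡0 → ℚ.1≢0 (begin
  1ℚ                       ≡⟨ sym (diag-on (λ _ → 1ℚ) j) ⟩
  1ₘ {n} j j               ≡⟨ sym (NM≐1 j j) ⟩
  ∑ (λ l → N j l * M l j)  ≡⟨ ∑-cong (λ l → cong (N j l *_) (column≡0 l)) ⟩
  ∑ (λ l → N j l * 0ℚ)     ≡⟨ ∑-cong (λ l → ℚ.*-zeroʳ (N j l)) ⟩
  ∑ {n} (λ _ → 0ℚ)         ≡⟨ ∑-zero n ⟩
  0ℚ                       ∎)
  where open ≡-Reasoning

intertwined-SameTupleSet : ∀ {n t} {u u′ : Fin t → Vect n} (M : Mat n n) →
                           Invertible M → Intertwines M u u′ → SameTupleSet u u′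
intertwined-SameTupleSet M (N , MN≐1 , NM≐1) uM≐Mu′ =
    (λ i → let (j , Mij≢0) = row-nonzero M N MN≐1 i
           in j , λ a → intertwiner-support M (uM≐Mu′ a) Mij≢0)
  , (λ j → let (i , Mij≢0) = column-nonzero M N NM≐1 j
           in i , λ a → intertwiner-support M (uM≐Mu′ a) Mij≢0)

single-entry-columns⇒monomial :
  ∀ {n} (M : Mat n n) → Invertible M → (∀ {i k j} → M i j ≢ 0ℚ → M k j ≢ 0ℚ → i ≡ k) →
  Σ (Permutation′ n) λ σ → Σ (Vect n) λ d → (∀ i → ¬ (d i ≡ 0ℚ)) × (M ≐ diag d ⊗ permMat σ)
single-entry-columns⇒monomial {n} M (N , MN≐1 , NM≐1) single-entry = σ , d , d≢0 , M≐dσ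
  where
  ρ τ : Fin n → Fin n
  ρ i = proj₁ (row-nonzero M N MN≐1 i)
  τ j = proj₁ (column-nonzero M N NM≐1 j)

  d : Vect n
  d i = M i (ρ i)

  d≢0 : ∀ i → d i ≢ 0ℚ
  d≢0 i = proj₂ (row-nonzero M N MN≐1 i)

  Mτj≢0 : ∀ j → M (τ j) j ≢ 0ℚ
  Mτj≢0 j = proj₂ (column-nonzero M N NM≐1 j)

  support⇒τ : ∀ {i j} → M i j ≢ 0ℚ → i ≡ τ j
  support⇒τ Mij≢0 = single-entry Mij≢0 (Mτj≢0 _)

  NM-entry : ∀ j j′ → (N ⊗ M) j j′ ≡ N j (τ j′) * M (τ j′) j′
  NM-entry j j′ = ∑-single (τ j′) (λ l → N j l * M l j′) λ l l≢τj′ →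
    trans (cong (N j l *_) (decidable-stable (M l j′ ℚ.≟ 0ℚ) (l≢τj′ ∘ support⇒τ)))
          (ℚ.*-zeroʳ (N j l))

  -- Off the diagonal, (NM)_{jj′} = N_{j,τj′} M_{τj′,j′} vanishes, so N_{j,τj′} = 0;
  -- on the diagonal N_{j,τj} M_{τj,j} = 1, hence τj ≢ τj′.
  τ-injective : ∀ {j j′} → τ j ≡ τ j′ → j ≡ j′
  τ-injective {j} {j′} τj≡τj′ = decidable-stable (j ≟ j′) λ j≢j′ → ℚ.1≢0 (begin
    1ℚ                      ≡⟨ sym (diag-on (λ _ → 1ℚ) j) ⟩
    1ₘ j j                  ≡⟨ sym (NM≐1 j j) ⟩
    (N ⊗ M) j j             ≡⟨ NM-entry j j ⟩
    N j (τ j) * M (τ j) j   ≡⟨ cong (λ l → N j l * M (τ j) j) τj≡τj′ ⟩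
    N j (τ j′) * M (τ j) j  ≡⟨ cong (_* M (τ j) j) (Njτj′≡0 j≢j′) ⟩
    0ℚ * M (τ j) j          ≡⟨ ℚ.*-zeroˡ (M (τ j) j) ⟩
    0ℚ                      ∎)
    where
    open ≡-Reasoning
    Njτj′≡0 : j ≢ j′ → N j (τ j′) ≡ 0ℚ
    Njτj′≡0 j≢j′ = *-cancelʳ-≡ (N j (τ j′)) 0ℚ (M (τ j′) j′) (Mτj≢0 j′) (begin
      N j (τ j′) * M (τ j′) j′  ≡⟨ sym (NM-entry j j′) ⟩
      (N ⊗ M) j j′              ≡⟨ NM≐1 j j′ ⟩
      1ₘ j j′                   ≡⟨ diag-off (λ _ → 1ℚ) j≢j′ ⟩
      0ℚ                        ≡⟨ sym (ℚ.*-zeroˡ (M (τ j′) j′)) ⟩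
      0ℚ * M (τ j′) j′          ∎)

  τ∘ρ≗id : ∀ i → τ (ρ i) ≡ i
  τ∘ρ≗id i = sym (support⇒τ (d≢0 i))

  ρ∘τ≗id : ∀ j → ρ (τ j) ≡ j
  ρ∘τ≗id j = τ-injective (τ∘ρ≗id (τ j))

  σ : Permutation′ n
  σ = permutation ρ τ ρ∘τ≗id τ∘ρ≗id

  -- permMat σ i j is definitionally 1ₘ (ρ i) j.
  dσ-entry : ∀ i j → d i * 1ₘ (ρ i) j ≡ M i j
  dσ-entry i j with ρ i ≟ j
  ... | yes refl = ℚ.*-identityʳ (d i)
  ... | no ρi≢j  = trans (ℚ.*-zeroʳ (d i)) (sym (decidable-stable (M i j ℚ.≟ 0ℚ) λ Mij≢0 →
                     ρi≢j (trans (cong ρ (support⇒τ Mij≢0)) (ρ∘τ≗id j))))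

  M≐dσ : M ≐ diag d ⊗ permMat σ
  M≐dσ i j = sym (trans (diag-⊗ d (permMat σ) i j) (dσ-entry i j))

decomposition-intertwiner :
  ∀ {p n k t} (u : Fin t → Vect n) (P : Mat p n) (Q : Mat n n) (E : Mat n k) (W₀⁺ : Mat n p) →
  ColumnsSpanKer E (P ⊗ Q) → (P ⊗ Q) ⊗ W₀⁺ ≐ 1ₘ →
  UniquelySolvableC′ E (λ a → W₀⁺ ⊗ (P ⊗ diag (u a) ⊗ Q)) → Invertible Q →
  ∀ (P′ : Mat p n) (Q′ : Mat n n) (u′ : Fin t → Vect n) →
  IsDecomposition (P ⊗ Q) (λ a → P ⊗ diag (u a) ⊗ Q) P′ Q′ u′ →
  ∃ λ (M : Mat n n) → Invertible M × Intertwines M u u′ × (M ⊗ Q′ ≐ Q)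
decomposition-intertwiner {p} {n} {k} {t} u P Q E W₀⁺ span W₀W₀⁺≐1 C′-unique (Qi , QQi≐1 , QiQ≐1)
                          P′ Q′ u′ (_ , (Q′i , Q′Q′i≐1 , Q′iQ′≐1) , W₀≐P′Q′ , W≐P′U′Q′) =
    Q ⊗ Q′i
  , (Q′ ⊗ Qi , ⊗-inverse Q Qi Q′i Q′ QQi≐1 Q′iQ′≐1 , ⊗-inverse Q′ Q′i Qi Q Q′Q′i≐1 QiQ≐1)
  , (λ a → conjugates-≐⇒intertwine Q Qi Q′ Q′i (diag (u a)) (diag (u′ a)) QQi≐1 Q′Q′i≐1 (Z≐Z′ a))
  , ⊗-cancelʳ Q′i Q′ Q Q′iQ′≐1
  where
  W : Fin t → Mat p n
  W a = P ⊗ diag (u a) ⊗ Q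

  Z Z′ : Fin t → Mat n n
  Z  a = Qi ⊗ diag (u a) ⊗ Q
  Z′ a = Q′i ⊗ diag (u′ a) ⊗ Q′

  W₀Z′≐W : ∀ a → (P ⊗ Q) ⊗ Z′ a ≐ W a
  W₀Z′≐W a = begin
    (P ⊗ Q) ⊗ Z′ a         ≈⟨ ⊗-congʳ (Z′ a) W₀≐P′Q′ ⟩
    (P′ ⊗ Q′) ⊗ Z′ a       ≈⟨ ⊗-conjugate P′ Q′ Q′i (diag (u′ a)) Q′Q′i≐1 ⟩
    P′ ⊗ diag (u′ a) ⊗ Q′  ≈⟨ ≐-sym (W≐P′U′Q′ a) ⟩
    W a                    ∎
    where open ≐-Reasoning

  Z≐Z′ : ∀ a → Z a ≐ Z′ a
  Z≐Z′ = commuting-lifts-unique (P ⊗ Q) W₀⁺ E W span W₀W₀⁺≐1 C′-unique Z Z′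
    (λ a → ⊗-conjugate P Q Qi (diag (u a)) QQi≐1) W₀Z′≐W
    (λ a b → conjugate-comm Q Qi (diag (u a)) (diag (u b)) QQi≐1 (diag-comm (u a) (u b)))
    (λ a b → conjugate-comm Q′ Q′i (diag (u′ a)) (diag (u′ b)) Q′Q′i≐1 (diag-comm (u′ a) (u′ b)))

proposition3p2 :
    (n t p : ℕ) → 2 ≤ n → 2 ≤ t → 2 ≤ p → p < n →
    (u : Fin t → Vect n) (P : Mat p n) (Q : Mat n n) →
    HasFullRowRank P → Invertible Q →
    (E : Mat n (n ∸ p)) → ColumnsBasisOfKer E (P ⊗ Q) →
    (W₀⁺ : Mat n p) → ((P ⊗ Q) ⊗ W₀⁺) ≐ 1ₘ →
    UniquelySolvableC′ E (λ a → W₀⁺ ⊗ (P ⊗ diag (u a) ⊗ Q)) →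
    (∀ (P′ : Mat p n) (Q′ : Mat n n) (u′ : Fin t → Vect n) →
       IsDecomposition (P ⊗ Q) (λ a → P ⊗ diag (u a) ⊗ Q) P′ Q′ u′ →
       SameTupleSet u u′)
    ×
    ((∃ λ (a : Fin t) → PairwiseDistinct (u a)) →
     ∀ (P′ : Mat p n) (Q′ : Mat n n) (u′ : Fin t → Vect n) →
       IsDecomposition (P ⊗ Q) (λ a → P ⊗ diag (u a) ⊗ Q) P′ Q′ u′ →
       Σ (Permutation′ n) λ σ → Σ (Vect n) λ d →
         (∀ i → ¬ (d i ≡ 0ℚ)) × (Q ≐ (diag d ⊗ permMat σ ⊗ Q′)))
proposition3p2 n t p _ _ _ _ u P Q _ Q-inv E (_ , _ , span) W₀⁺ W₀W₀⁺≐1 C′-unique =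
    (λ P′ Q′ u′ decomposition →
       let (M , M-inv , uM≐Mu′ , _) = intertwiner P′ Q′ u′ decomposition
       in intertwined-SameTupleSet M M-inv uM≐Mu′)
  , λ (a₀ , ua₀-distinct) P′ Q′ u′ decomposition →
       let (M , M-inv , uM≐Mu′ , MQ′≐Q) = intertwiner P′ Q′ u′ decomposition
           support = intertwiner-support M (uM≐Mu′ a₀)
           (σ , d , d≢0 , M≐dσ) = single-entry-columns⇒monomial M M-inv λ Mij≢0 Mkj≢0 →
                                    ua₀-distinct _ _ (trans (support Mij≢0) (sym (support Mkj≢0)))
       in σ , d , d≢0 , ≐-trans (≐-sym MQ′≐Q) (⊗-congʳ Q′ M≐dσ)
  where
  intertwiner : ∀ P′ Q′ u′ → IsDecomposition (P ⊗ Q) (λ a → P ⊗ diag (u a) ⊗ Q) P′ Q′ u′ →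
                ∃ λ (M : Mat n n) → Invertible M × Intertwines M u u′ × (M ⊗ Q′ ≐ Q)
  intertwiner = decomposition-intertwiner u P Q E W₀⁺ span W₀W₀⁺≐1 C′-unique Q-inv
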